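{- Let $\boldsymbol w\in\{0,1\}^\omega$. Then $\varphi(\boldsymbol w)$ is faux-bonacci if and only if $\boldsymbol w$ is faux-bonacci.
   Context: Words are over the binary alphabet $\{0,1\}$; an $\omega$-word is an infinite word indexed by the positive integers. $\varphi$ is the morphism $\varphi(0)=01$, $\varphi(1)=0$. For a non-empty word $X$, $X^-$ denotes $X$ with its last letter erased. A $4^-$-power is a word $XXXX^-$ with $X$ non-empty. A binary word is faux-bonacci if it contains no factor $11$ and no factor that is a $4^-$-power. -}

module Defs where

open import Data.Nat using (ℕ; zero; suc; _+_)
open import Data.List using (List; []; _∷_; _++_; length; lookup)
open import Data.Fin using (Fin; toℕ)
open import Data.Product using (∃; _×_)
open import Relation.Binary.PropositionalEquality using (_≡_; _≢_)
open import Relation.Nullary using (¬_)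

data Bit : Set where
  b0 b1 : Bit

Word : Set
Word = List Bit

-- ω-words: position 1,2,3,... of the paper is index 0,1,2,... here
ωWord : Set
ωWord = ℕ → Bit

φ : Bit → Word
φ b0 = b0 ∷ b1 ∷ []
φ b1 = b0 ∷ []

tailω : ωWord → ωWord
tailω w n = w (suc n)

-- φ applied to an ω-word: the concatenation φ(w 0) φ(w 1) φ(w 2) ...
-- φω w n is the letter at index n of that concatenation
φω : ωWord → ωWord
φω w n with w 0
φω w zero          | b0 = b0
φω w (suc zero)    | b0 = b1
φω w (suc (suc n)) | b0 = φω (tailω w) n
φω w zero          | b1 = b0
φω w (suc n)       | b1 = φω (tailω w) n

_⁻ : Word → Word
[] ⁻ = []
(x ∷ []) ⁻ = []
(x ∷ y ∷ xs) ⁻ = x ∷ ((y ∷ xs) ⁻)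

Factor : Word → ωWord → Set
Factor u w = ∃ λ (i : ℕ) → (j : Fin (length u)) → w (i + toℕ j) ≡ lookup u j

fourMinus : Word → Word
fourMinus X = X ++ X ++ X ++ (X ⁻)

FauxBonacci : ωWord → Set
FauxBonacci w =
  ¬ Factor (b1 ∷ b1 ∷ []) w ×
  ((X : Word) → X ≢ [] → ¬ Factor (fourMinus X) w)

-- φω w is the concatenation of the blocks φ (w k) ∈ {01, 0}.  Its zeros are exactly the block
-- starts, and the letter after the start of the block of w k is the complement of w k, so a
-- stretch of φω w beginning at a block start spells out the corresponding stretch of w.
-- Reading blocks in lockstep, a 4⁻-power of period q at m in w gives a 4⁻-power of φω w whose
-- period is the total length of the q blocks from w m on; conversely a 4⁻-power of φω w, moved
-- one letter to the left if it starts with 1, starts at a block and comes from a 4⁻-power of w.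
-- The exception is period 1, i.e. the factor 000, which occurs in φω w exactly when 11 occurs
-- in w.  Finally φω w never contains 11: every 1 is followed by the 0 starting the next block.
module Submission where

open import Defs
open import Function.Base using (_∘_)
open import Function.Bundles using (_⇔_; mk⇔; module Equivalence)
open import Data.Nat
open import Data.Nat.Properties
open import Data.Nat.Tactic.RingSolver using (solve-∀)
open import Data.List using (List; []; _∷_; _++_; length; lookup; applyUpTo)
open import Data.List.Properties
  using (∷-injective; ∷-injectiveˡ; ∷-injectiveʳ; ++-assoc; length-++; length-applyUpTo; lookup-applyUpTo)
open import Data.Fin using (Fin; toℕ)
open import Data.Product using (∃; ∃₂; _×_; _,_; proj₁; proj₂; map₁; map₂)
open import Data.Product.Function.NonDependent.Propositional using (_×-⇔_)
open import Data.Sum using (_⊎_; inj₁; inj₂)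
open import Data.Empty using (⊥; ⊥-elim)
open import Relation.Binary.PropositionalEquality
open import Relation.Nullary using (¬_; yes; no)
open import Algebra.Properties.CommutativeSemigroup +-commutativeSemigroup
  using (x∙yz≈xz∙y; x∙yz≈y∙xz; xy∙z≈xz∙y)

open Equivalence

applyUpTo-++ : ∀ {A : Set} (f : ℕ → A) m n →
  applyUpTo f (m + n) ≡ applyUpTo f m ++ applyUpTo (f ∘ (m +_)) n
applyUpTo-++ f zero    n = refl
applyUpTo-++ f (suc m) n = cong (f 0 ∷_) (applyUpTo-++ (f ∘ suc) m n)

applyUpTo-cong : ∀ {A : Set} {f g : ℕ → A} n →
  (∀ j → j < n → f j ≡ g j) → applyUpTo f n ≡ applyUpTo g n
applyUpTo-cong zero    _  = refl
applyUpTo-cong (suc n) eq = cong₂ _∷_ (eq 0 z<s) (applyUpTo-cong n (λ j j<n → eq (suc j) (s<s j<n)))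

applyUpTo-cong⁻ : ∀ {A : Set} (f g : ℕ → A) n →
  applyUpTo f n ≡ applyUpTo g n → ∀ j → j < n → f j ≡ g j
applyUpTo-cong⁻ f g (suc n) eq zero    _         = ∷-injectiveˡ eq
applyUpTo-cong⁻ f g (suc n) eq (suc j) (s<s j<n) =
  applyUpTo-cong⁻ (f ∘ suc) (g ∘ suc) n (∷-injectiveʳ eq) j j<n

applyUpTo-lookup : ∀ {A : Set} (f : ℕ → A) (xs : List A) →
  (∀ j → f (toℕ j) ≡ lookup xs j) → applyUpTo f (length xs) ≡ xs
applyUpTo-lookup f []       _  = refl
applyUpTo-lookup f (x ∷ xs) eq = cong₂ _∷_ (eq Fin.zero) (applyUpTo-lookup (f ∘ suc) xs (eq ∘ Fin.suc))

++-injective : ∀ {A : Set} (xs xs′ : List A) {ys ys′ : List A} →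
  length xs ≡ length xs′ → xs ++ ys ≡ xs′ ++ ys′ → xs ≡ xs′ × ys ≡ ys′
++-injective []       []         _   eq = refl , eq
++-injective (x ∷ xs) (x′ ∷ xs′) len eq with ∷-injective eq
... | refl , eq′ = map₁ (cong (x ∷_)) (++-injective xs xs′ (suc-injective len) eq′)

length-⁻ : ∀ x X → length ((x ∷ X) ⁻) ≡ length X
length-⁻ x []      = refl
length-⁻ x (y ∷ X) = cong suc (length-⁻ y X)

⁻-∷ʳ : ∀ x X → ∃ λ y → (x ∷ X) ⁻ ++ y ∷ [] ≡ x ∷ X
⁻-∷ʳ x []      = x , refl
⁻-∷ʳ x (y ∷ X) = map₂ (cong (x ∷_)) (⁻-∷ʳ y X)

applyUpTo-⁻ : ∀ (f : ℕ → Bit) n → applyUpTo f (suc n) ⁻ ≡ applyUpTo f n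
applyUpTo-⁻ f zero    = refl
applyUpTo-⁻ f (suc n) = cong (f 0 ∷_) (applyUpTo-⁻ (f ∘ suc) n)

-- Factors and 4⁻-powers

b0≢b1 : b0 ≢ b1
b0≢b1 ()

factorAt : ωWord → ℕ → ℕ → Word
factorAt u i = applyUpTo (λ j → u (i + j))

factorAt-Factor : ∀ u i n → Factor (factorAt u i n) u
factorAt-Factor u i n = i , λ j → sym (lookup-applyUpTo (λ j → u (i + j)) n j)

Factor⇒factorAt : ∀ v u → Factor v u → ∃ λ i → factorAt u i (length v) ≡ v
Factor⇒factorAt v u (i , occ) = i , applyUpTo-lookup _ v occ

factorAt-++⁻ : ∀ u i A B → factorAt u i (length (A ++ B)) ≡ A ++ B →
  factorAt u i (length A) ≡ A × applyUpTo (λ j → u (i + (length A + j))) (length B) ≡ B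
factorAt-++⁻ u i A B eq = ++-injective _ A (length-applyUpTo _ (length A)) (begin
  factorAt u i (length A) ++ applyUpTo (λ j → u (i + (length A + j))) (length B)
                                      ≡⟨ applyUpTo-++ _ (length A) (length B) ⟨
  factorAt u i (length A + length B)  ≡⟨ cong (factorAt u i) (length-++ A) ⟨
  factorAt u i (length (A ++ B))      ≡⟨ eq ⟩
  A ++ B                              ∎)
  where open ≡-Reasoning

NoEleven : ωWord → Set
NoEleven u = ∀ i → u i ≡ b1 → u (suc i) ≡ b1 → ⊥

Periodic : ωWord → (p i n : ℕ) → Set
Periodic u p i n = ∀ j → j < n → u (i + j) ≡ u (i + j + p)

-- The factor of length 4p - 1 at i, where p = suc r, is a 4⁻-power of period p.
FourMinusAt : ωWord → ℕ → ℕ → Set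
FourMinusAt u i r = Periodic u (suc r) i (suc r + (suc r + r))

NoFourMinus : ωWord → Set
NoFourMinus u = ∀ i r → ¬ FourMinusAt u i r

periodic-at : ∀ u p i n → Periodic u p i n → ∀ {x} → i ≤ x → x < i + n → u x ≡ u (x + p)
periodic-at u p i n per i≤x x<i+n with m≤n⇒∃[o]m+o≡n i≤x
... | j , refl = per j (+-cancelˡ-< i _ _ x<i+n)

FourMinusAt-start : ∀ u i r → FourMinusAt u i r → u i ≡ u (i + suc r)
FourMinusAt-start u i r per = periodic-at u (suc r) i _ per ≤-refl (m<m+n i z<s)

factorAt-periodic : ∀ u p i n → Periodic u p i n →
  ∀ n′ → n′ ≤ n → factorAt u i (p + n′) ≡ factorAt u i p ++ factorAt u i n′
factorAt-periodic u p i n per n′ n′≤n = begin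
  factorAt u i (p + n′)                                   ≡⟨ applyUpTo-++ _ p n′ ⟩
  factorAt u i p ++ applyUpTo (λ j → u (i + (p + j))) n′  ≡⟨ cong (factorAt u i p ++_) (applyUpTo-cong n′ shift) ⟩
  factorAt u i p ++ factorAt u i n′                       ∎
  where
  open ≡-Reasoning
  shift : ∀ j → j < n′ → u (i + (p + j)) ≡ u (i + j)
  shift j j<n′ = trans (cong u (x∙yz≈xz∙y i p j)) (sym (per j (<-≤-trans j<n′ n′≤n)))

FourMinusAt⇒Factor : ∀ u i r → FourMinusAt u i r → Factor (fourMinus (factorAt u i (suc r))) u
FourMinusAt⇒Factor u i r per = subst (λ v → Factor v u) unfold (factorAt-Factor u i (p + (p + (p + r))))
  where
  open ≡-Reasoning
  p = suc r
  X = factorAt u i p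
  split : ∀ n′ → n′ ≤ p + (p + r) → factorAt u i (p + n′) ≡ X ++ factorAt u i n′
  split = factorAt-periodic u p i (p + (p + r)) per
  unfold : factorAt u i (p + (p + (p + r))) ≡ fourMinus X
  unfold = begin
    factorAt u i (p + (p + (p + r)))  ≡⟨ split (p + (p + r)) ≤-refl ⟩
    X ++ factorAt u i (p + (p + r))   ≡⟨ cong (X ++_) (split (p + r) (m≤n+m _ p)) ⟩
    X ++ X ++ factorAt u i (p + r)    ≡⟨ cong (λ v → X ++ X ++ v) (split r (≤-trans (m≤n+m r p) (m≤n+m _ p))) ⟩
    X ++ X ++ X ++ factorAt u i r     ≡⟨ cong (λ v → X ++ X ++ X ++ v) (applyUpTo-⁻ _ r) ⟨
    fourMinus X                       ∎

Factor⇒FourMinusAt : ∀ u X → X ≢ [] → Factor (fourMinus X) u → ∃₂ λ i r → FourMinusAt u i r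
Factor⇒FourMinusAt u []      X≢[] _   = ⊥-elim (X≢[] refl)
Factor⇒FourMinusAt u (x ∷ X) _ occ with Factor⇒factorAt (fourMinus (x ∷ X)) u occ | ⁻-∷ʳ x X
... | i , eq | y , X⁻y≡X = i , length X , periodic
  where
  open ≡-Reasoning
  Y = x ∷ X
  p = suc (length X)
  B = Y ++ Y ++ Y ⁻
  fourMinus≡B++ : fourMinus Y ≡ B ++ y ∷ Y ⁻
  fourMinus≡B++ = begin
    Y ++ Y ++ Y ++ Y ⁻                ≡⟨ cong (λ Z → Y ++ Y ++ Z ++ Y ⁻) X⁻y≡X ⟨
    Y ++ Y ++ (Y ⁻ ++ y ∷ []) ++ Y ⁻  ≡⟨ cong (λ Z → Y ++ Y ++ Z) (++-assoc (Y ⁻) (y ∷ []) (Y ⁻)) ⟩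
    Y ++ Y ++ Y ⁻ ++ y ∷ Y ⁻          ≡⟨ cong (Y ++_) (++-assoc Y (Y ⁻) (y ∷ Y ⁻)) ⟨
    Y ++ (Y ++ Y ⁻) ++ y ∷ Y ⁻        ≡⟨ ++-assoc Y (Y ++ Y ⁻) (y ∷ Y ⁻) ⟨
    B ++ y ∷ Y ⁻                      ∎
  shifted : applyUpTo (λ j → u (i + (p + j))) (length B) ≡ B
  shifted = proj₂ (factorAt-++⁻ u i Y B eq)
  prefix : factorAt u i (length B) ≡ B
  prefix = proj₁ (factorAt-++⁻ u i B (y ∷ Y ⁻)
                    (subst (λ v → factorAt u i (length v) ≡ v) fourMinus≡B++ eq))
  length-B : length B ≡ p + (p + length X)
  length-B = begin
    length (Y ++ Y ++ Y ⁻)  ≡⟨ length-++ Y ⟩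
    p + length (Y ++ Y ⁻)   ≡⟨ cong (p +_) (length-++ Y) ⟩
    p + (p + length (Y ⁻))  ≡⟨ cong (λ n → p + (p + n)) (length-⁻ x X) ⟩
    p + (p + length X)      ∎
  periodic : FourMinusAt u i (length X)
  periodic j j<n = begin
    u (i + j)        ≡⟨ applyUpTo-cong⁻ (λ j → u (i + (p + j))) (λ j → u (i + j)) (length B)
                          (trans shifted (sym prefix)) j (subst (j <_) (sym length-B) j<n) ⟨
    u (i + (p + j))  ≡⟨ cong u (x∙yz≈xz∙y i p j) ⟩
    u (i + j + p)    ∎

NoEleven⇔ : ∀ u → (¬ Factor (b1 ∷ b1 ∷ []) u) ⇔ NoEleven u
NoEleven⇔ u = mk⇔
  (λ no11 i ui≡1 ui+1≡1 → no11 (eleven i ui≡1 ui+1≡1))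
  (λ no11 (i , occ) → no11 i (trans (cong u (sym (+-identityʳ i))) (occ Fin.zero))
                             (trans (cong u (+-comm 1 i)) (occ (Fin.suc Fin.zero))))
  where
  eleven : ∀ i → u i ≡ b1 → u (suc i) ≡ b1 → Factor (b1 ∷ b1 ∷ []) u
  eleven i ui≡1 ui+1≡1 = i , λ where
    Fin.zero           → trans (cong u (+-identityʳ i)) ui≡1
    (Fin.suc Fin.zero) → trans (cong u (+-comm i 1)) ui+1≡1

NoFourMinus⇔ : ∀ u → (∀ X → X ≢ [] → ¬ Factor (fourMinus X) u) ⇔ NoFourMinus u
NoFourMinus⇔ u = mk⇔
  (λ no4⁻ i r per → no4⁻ (factorAt u i (suc r)) (λ ()) (FourMinusAt⇒Factor u i r per))
  (λ no4⁻ X X≢[] occ → let (i , r , per) = Factor⇒FourMinusAt u X X≢[] occ in no4⁻ i r per)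

FauxBonacci⇔ : ∀ u → FauxBonacci u ⇔ (NoEleven u × NoFourMinus u)
FauxBonacci⇔ u = NoEleven⇔ u ×-⇔ NoFourMinus⇔ u

cube⇒FourMinusAt : ∀ u i → u i ≡ u (suc i) → u (suc i) ≡ u (suc (suc i)) → FourMinusAt u i 0
cube⇒FourMinusAt u i e₀ e₁ j j<2 = trans (consecutive j j<2) (cong u (+-comm 1 (i + j)))
  where
  consecutive : ∀ j → j < 2 → u (i + j) ≡ u (suc (i + j))
  consecutive 0 _ = subst (λ x → u x ≡ u (suc x)) (sym (+-identityʳ i)) e₀
  consecutive 1 _ = subst (λ x → u x ≡ u (suc x)) (sym (+-comm i 1)) e₁
  consecutive (suc (suc j)) (s<s (s<s ()))

FourMinusAt⇒cube : ∀ u i → FourMinusAt u i 0 → u i ≡ u (suc i) × u (suc i) ≡ u (suc (suc i))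
FourMinusAt⇒cube u i per = subst (λ x → u x ≡ u (suc x)) (+-identityʳ i) (consecutive 0 z<s)
                         , subst (λ x → u x ≡ u (suc x)) (+-comm i 1) (consecutive 1 (s<s z<s))
  where
  consecutive : ∀ j → j < 2 → u (i + j) ≡ u (suc (i + j))
  consecutive j j<2 = trans (per j j<2) (cong u (+-comm (i + j) 1))

-- Without 11 every 1 is preceded by 0, so a 4⁻-power starting with 1 can be shifted one letter to the left.
FourMinusAt-at-zero : ∀ u → NoEleven u → u 0 ≡ b0 → ∀ i r → FourMinusAt u i r →
  ∃ λ i′ → u i′ ≡ b0 × FourMinusAt u i′ r
FourMinusAt-at-zero u noEleven u0≡0 i r per with u i in ui
... | b0 = i , ui , per
FourMinusAt-at-zero u noEleven u0≡0 zero r per    | b1 = ⊥-elim (b0≢b1 (trans (sym u0≡0) ui))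
FourMinusAt-at-zero u noEleven u0≡0 (suc i) r per | b1 = i , before-one ui , per′
  where
  open ≡-Reasoning
  p = suc r
  before-one : ∀ {x} → u (suc x) ≡ b1 → u x ≡ b0
  before-one {x} ux+1≡1 with u x in ux
  ... | b0 = refl
  ... | b1 = ⊥-elim (noEleven x ux ux+1≡1)
  following-one : u (suc (i + p)) ≡ b1
  following-one = begin
    u (suc i + p)      ≡⟨ cong (λ x → u (x + p)) (+-identityʳ (suc i)) ⟨
    u (suc i + 0 + p)  ≡⟨ per 0 z<s ⟨
    u (suc i + 0)      ≡⟨ cong u (+-identityʳ (suc i)) ⟩
    u (suc i)          ≡⟨ ui ⟩
    b1                 ∎
  per′ : FourMinusAt u i r
  per′ zero _ = begin
    u (i + 0)          ≡⟨ cong u (+-identityʳ i) ⟩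
    u i                ≡⟨ before-one ui ⟩
    b0                 ≡⟨ before-one following-one ⟨
    u (i + p)          ≡⟨ cong (λ x → u (x + p)) (+-identityʳ i) ⟨
    u (i + 0 + p)      ∎
  per′ (suc j) j+1<n = begin
    u (i + suc j)      ≡⟨ cong u (+-suc i j) ⟩
    u (suc i + j)      ≡⟨ per j (<-trans (n<1+n j) j+1<n) ⟩
    u (suc i + j + p)  ≡⟨ cong (λ x → u (x + p)) (+-suc i j) ⟨
    u (i + suc j + p)  ∎

-- The blocks of φω w

complement : Bit → Bit
complement b0 = b1
complement b1 = b0

complement-injective : ∀ {a b} → complement a ≡ complement b → a ≡ b
complement-injective {b0} {b0} _ = refl
complement-injective {b1} {b1} _ = refl

-- φω w = φ (w 0) φ (w 1) …, and the block φ (w k) starts at index pos w k.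
pos : ωWord → ℕ → ℕ
pos w zero    = 0
pos w (suc k) = length (φ (w 0)) + pos (tailω w) k

φω-tail : ∀ w n → φω w (length (φ (w 0)) + n) ≡ φω (tailω w) n
φω-tail w n with w 0
... | b0 = refl
... | b1 = refl

φω-head : ∀ w → φω w 0 ≡ b0
φω-head w with w 0
... | b0 = refl
... | b1 = refl

φω-second : ∀ w → φω w 1 ≡ complement (w 0)
φω-second w with w 0
... | b0 = refl
... | b1 = φω-head (tailω w)

φω-pos : ∀ w k → φω w (pos w k) ≡ b0
φω-pos w zero    = φω-head w
φω-pos w (suc k) = trans (φω-tail w (pos (tailω w) k)) (φω-pos (tailω w) k)

-- The letter after the start of φ (w k) is the 1 of φ 0 = 01 or the 0 starting the next block.
φω-suc-pos : ∀ w k → φω w (suc (pos w k)) ≡ complement (w k)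
φω-suc-pos w zero    = φω-second w
φω-suc-pos w (suc k) = begin
  φω w (suc (length (φ (w 0)) + pos (tailω w) k))  ≡⟨ cong (φω w) (+-suc _ _) ⟨
  φω w (length (φ (w 0)) + suc (pos (tailω w) k))  ≡⟨ φω-tail w _ ⟩
  φω (tailω w) (suc (pos (tailω w) k))             ≡⟨ φω-suc-pos (tailω w) k ⟩
  complement (w (suc k))                           ∎
  where open ≡-Reasoning

pos-suc : ∀ w k → pos w (suc k) ≡ length (φ (w k)) + pos w k
pos-suc w zero    = refl
pos-suc w (suc k) = trans (cong (length (φ (w 0)) +_) (pos-suc (tailω w) k))
                          (x∙yz≈y∙xz (length (φ (w 0))) (length (φ (w (suc k)))) (pos (tailω w) k))

pos-suc-of : ∀ w {k b} → w k ≡ b → pos w (suc k) ≡ length (φ b) + pos w k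
pos-suc-of w {k} refl = pos-suc w k

pos-<-suc : ∀ w k → pos w k < pos w (suc k)
pos-<-suc w k = subst (pos w k <_) (sym (pos-suc w k)) (m<n+m (pos w k) (φ-nonempty (w k)))
  where
  φ-nonempty : ∀ b → 0 < length (φ b)
  φ-nonempty b0 = z<s
  φ-nonempty b1 = z<s

pos-mono-< : ∀ w {k l} → k < l → pos w k < pos w l
pos-mono-< w {k} {suc l} k<1+l with m≤n⇒m<n∨m≡n (s≤s⁻¹ k<1+l)
... | inj₁ k<l  = <-trans (pos-mono-< w k<l) (pos-<-suc w l)
... | inj₂ refl = pos-<-suc w k

pos-mono-≤ : ∀ w {k l} → k ≤ l → pos w k ≤ pos w l
pos-mono-≤ w k≤l with m≤n⇒m<n∨m≡n k≤l
... | inj₁ k<l  = <⇒≤ (pos-mono-< w k<l)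
... | inj₂ refl = ≤-refl

pos-cancel-< : ∀ w {k l} → pos w k < pos w l → k < l
pos-cancel-< w lt = ≰⇒> (λ l≤k → <⇒≱ lt (pos-mono-≤ w l≤k))

pos-cancel-≤ : ∀ w {k l} → pos w k ≤ pos w l → k ≤ l
pos-cancel-≤ w le = ≮⇒≥ (λ l<k → <⇒≱ (pos-mono-< w l<k) le)

InBlock : ωWord → ℕ → ℕ → Set
InBlock w n k = n ≡ pos w k ⊎ (n ≡ suc (pos w k) × w k ≡ b0)

inBlock-tail : ∀ {w b n} → w 0 ≡ b → ∃ (InBlock (tailω w) n) → ∃ (InBlock w (length (φ b) + n))
inBlock-tail {w} refl (k , inj₁ n≡)          = suc k , inj₁ (cong (length (φ (w 0)) +_) n≡)
inBlock-tail {w} refl (k , inj₂ (n≡ , wk≡0)) =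
  suc k , inj₂ (trans (cong (length (φ (w 0)) +_) n≡) (+-suc _ _) , wk≡0)

inBlock : ∀ w n → ∃ (InBlock w n)
inBlock w zero = 0 , inj₁ refl
inBlock w (suc n) with w 0 in e | n
... | b1 | m      = inBlock-tail e (inBlock (tailω w) m)
... | b0 | zero   = 0 , inj₂ (refl , e)
... | b0 | suc n′ = inBlock-tail e (inBlock (tailω w) n′)

φω-zero⇒pos : ∀ w n → φω w n ≡ b0 → ∃ λ k → n ≡ pos w k
φω-zero⇒pos w n un≡0 with inBlock w n
... | k , inj₁ n≡            = k , n≡
... | k , inj₂ (refl , wk≡0) =
  ⊥-elim (b0≢b1 (trans (sym un≡0) (trans (φω-suc-pos w k) (cong complement wk≡0))))

φω-one⇒zero : ∀ w n → φω w n ≡ b1 → φω w (suc n) ≡ b0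
φω-one⇒zero w n un≡1 with inBlock w n
... | k , inj₁ refl          = ⊥-elim (b0≢b1 (trans (sym (φω-pos w k)) un≡1))
... | k , inj₂ (refl , wk≡0) = trans (cong (φω w) (sym (pos-suc-of w wk≡0))) (φω-pos w (suc k))

φω-noEleven : ∀ w → NoEleven (φω w)
φω-noEleven w i ui≡1 = b0≢b1 ∘ trans (sym (φω-one⇒zero w i ui≡1))

φω-no000 : ∀ w → NoEleven w → ∀ n →
  φω w n ≡ b0 → φω w (suc n) ≡ b0 → φω w (suc (suc n)) ≡ b0 → ⊥
φω-no000 w noEleven n un≡0 un+1≡0 un+2≡0 with φω-zero⇒pos w n un≡0
... | k , refl = noEleven k wk≡1 wk+1≡1
  where
  open ≡-Reasoning
  wk≡1 : w k ≡ b1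
  wk≡1 = complement-injective (trans (sym (φω-suc-pos w k)) un+1≡0)
  wk+1≡1 : w (suc k) ≡ b1
  wk+1≡1 = complement-injective (begin
    complement (w (suc k))           ≡⟨ φω-suc-pos w (suc k) ⟨
    φω w (suc (pos w (suc k)))       ≡⟨ cong (φω w ∘ suc) (pos-suc-of w wk≡1) ⟩
    φω w (suc (suc (pos w k)))       ≡⟨ un+2≡0 ⟩
    b0                               ∎)

pos-lockstep : ∀ w {k k′ p} → pos w k′ ≡ pos w k + p → ∀ t →
  (∀ s → s < t → pos w (k′ + s) ≡ pos w (k + s) + p → w (k′ + s) ≡ w (k + s)) →
  pos w (k′ + t) ≡ pos w (k + t) + p
pos-lockstep w {k} {k′} {p} aligned zero _ = begin
  pos w (k′ + 0)  ≡⟨ cong (pos w) (+-identityʳ k′) ⟩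
  pos w k′        ≡⟨ aligned ⟩
  pos w k + p     ≡⟨ cong (λ x → pos w x + p) (+-identityʳ k) ⟨
  pos w (k + 0) + p ∎
  where open ≡-Reasoning
pos-lockstep w {k} {k′} {p} aligned (suc t) agree = begin
  pos w (k′ + suc t)                            ≡⟨ cong (pos w) (+-suc k′ t) ⟩
  pos w (suc (k′ + t))                          ≡⟨ pos-suc w (k′ + t) ⟩
  length (φ (w (k′ + t))) + pos w (k′ + t)      ≡⟨ cong₂ (λ b x → length (φ b) + x) (agree t ≤-refl ih) ih ⟩
  length (φ (w (k + t))) + (pos w (k + t) + p)  ≡⟨ +-assoc (length (φ (w (k + t)))) (pos w (k + t)) p ⟨
  length (φ (w (k + t))) + pos w (k + t) + p    ≡⟨ cong (_+ p) (pos-suc w (k + t)) ⟨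
  pos w (suc (k + t)) + p                       ≡⟨ cong (λ x → pos w x + p) (+-suc k t) ⟨
  pos w (k + suc t) + p                         ∎
  where
  open ≡-Reasoning
  ih : pos w (k′ + t) ≡ pos w (k + t) + p
  ih = pos-lockstep w aligned t (λ s s<t → agree s (m<n⇒m<1+n s<t))

pos-suc-suc : ∀ w → NoEleven w → ∀ k → 3 + pos w k ≤ pos w (suc (suc k))
pos-suc-suc w noEleven k = subst (3 + pos w k ≤_)
  (sym (trans (pos-suc w (suc k)) (cong (length (φ (w (suc k))) +_) (pos-suc w k))))
  (two-blocks (pos w k) (noEleven k))
  where
  two-blocks : ∀ {a b} x → (a ≡ b1 → b ≡ b1 → ⊥) → 3 + x ≤ length (φ b) + (length (φ a) + x)
  two-blocks {b0} {b0} x _    = n≤1+n _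
  two-blocks {b0} {b1} x _    = ≤-refl
  two-blocks {b1} {b0} x _    = ≤-refl
  two-blocks {b1} {b1} x no11 = ⊥-elim (no11 refl refl)

-- Transporting 4⁻-powers through φ

split-index : ∀ {m k N} → m ≤ k → k < m + N → ∃ λ t → k ≡ m + t × t < N
split-index {m} m≤k k<m+N with m≤n⇒∃[o]m+o≡n m≤k
... | t , refl = t , refl , +-cancelˡ-< m _ _ k<m+N

module Substitution (w : ωWord) (m q r : ℕ) (per : FourMinusAt w m q)
                    (aligned : pos w (m + suc q) ≡ pos w m + suc r) where
  Q = suc q
  p = suc r
  n = Q + (Q + q)
  nᵤ = p + (p + r)
  u = φω w
  i = pos w m

  aligned-at : ∀ t → t ≤ n → pos w (m + Q + t) ≡ pos w (m + t) + p
  aligned-at t t≤n = pos-lockstep w {m} {m + Q} aligned t λ s s<t _ →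
    sym (trans (per s (<-≤-trans s<t t≤n)) (cong w (xy∙z≈xz∙y m s Q)))

  window-end : pos w (m + suc n) ≡ i + suc nᵤ
  window-end = begin
    pos w (m + suc n)        ≡⟨ cong (pos w) (regroup m q) ⟩
    pos w (m + Q + (Q + Q))  ≡⟨ aligned-at (Q + Q) (+-monoʳ-≤ Q (m≤m+n Q q)) ⟩
    pos w (m + (Q + Q)) + p  ≡⟨ cong (λ x → pos w x + p) (+-assoc m Q Q) ⟨
    pos w (m + Q + Q) + p    ≡⟨ cong (_+ p) (aligned-at Q (m≤m+n Q _)) ⟩
    pos w (m + Q) + p + p    ≡⟨ cong (λ x → x + p + p) aligned ⟩
    i + p + p + p            ≡⟨ regroup′ i r ⟩
    i + suc nᵤ               ∎
    where
    regroup : ∀ m q → m + suc (suc q + (suc q + q)) ≡ m + suc q + (suc q + suc q)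
    regroup = solve-∀
    regroup′ : ∀ i r → i + suc r + suc r + suc r ≡ i + suc (suc r + (suc r + r))
    regroup′ = solve-∀
    open ≡-Reasoning

  first-index : ∀ {j k} → j < nᵤ → i + j ≡ pos w k → ∃ λ t → k ≡ m + t × t < suc n
  first-index {j} {k} j<nᵤ first = split-index
    (pos-cancel-≤ w (≤-trans (m≤m+n i j) (≤-reflexive first)))
    (pos-cancel-< w (begin-strict
      pos w k             ≡⟨ first ⟨
      i + j               <⟨ +-monoʳ-< i (m<n⇒m<1+n j<nᵤ) ⟩
      i + suc nᵤ          ≡⟨ window-end ⟨
      pos w (m + suc n)   ∎))
    where open ≤-Reasoning

  second-index : ∀ {j k} → j < nᵤ → i + j ≡ suc (pos w k) → w k ≡ b0 → ∃ λ t → k ≡ m + t × t < n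
  second-index {j} {k} j<nᵤ second wk≡0 = split-index
    (s≤s⁻¹ (pos-cancel-< w (begin-strict
      i                   ≤⟨ m≤m+n i j ⟩
      i + j               <⟨ n<1+n _ ⟩
      suc (i + j)         ≡⟨ next ⟨
      pos w (suc k)       ∎)))
    (s≤s⁻¹ (subst (suc k <_) (+-suc m n) (pos-cancel-< w (begin-strict
      pos w (suc k)       ≡⟨ next ⟩
      suc (i + j)         ≡⟨ +-suc i j ⟨
      i + suc j           <⟨ +-monoʳ-< i (s<s j<nᵤ) ⟩
      i + suc nᵤ          ≡⟨ window-end ⟨
      pos w (m + suc n)   ∎))))
    where
    open ≤-Reasoning
    next : pos w (suc k) ≡ suc (i + j)
    next = trans (pos-suc-of w wk≡0) (cong suc (sym second))

  periodic : FourMinusAt u i r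
  periodic j j<nᵤ with inBlock w (i + j)
  ... | k , inj₁ first with first-index {k = k} j<nᵤ first
  ...   | t , refl , t<1+n = begin
    u (i + j)              ≡⟨ cong u first ⟩
    u (pos w (m + t))      ≡⟨ φω-pos w (m + t) ⟩
    b0                     ≡⟨ φω-pos w (m + Q + t) ⟨
    u (pos w (m + Q + t))  ≡⟨ cong u (aligned-at t (s≤s⁻¹ t<1+n)) ⟩
    u (pos w (m + t) + p)  ≡⟨ cong (λ x → u (x + p)) first ⟨
    u (i + j + p)          ∎
    where open ≡-Reasoning
  periodic j j<nᵤ | k , inj₂ (second , wk≡0) with second-index {k = k} j<nᵤ second wk≡0
  ...   | t , refl , t<n = begin
    u (i + j)                    ≡⟨ cong u second ⟩
    u (suc (pos w (m + t)))      ≡⟨ φω-suc-pos w (m + t) ⟩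
    complement (w (m + t))       ≡⟨ cong complement (trans (per t t<n) (cong w (xy∙z≈xz∙y m t Q))) ⟩
    complement (w (m + Q + t))   ≡⟨ φω-suc-pos w (m + Q + t) ⟨
    u (suc (pos w (m + Q + t)))  ≡⟨ cong (u ∘ suc) (aligned-at t (<⇒≤ t<n)) ⟩
    u (suc (pos w (m + t)) + p)  ≡⟨ cong (λ x → u (x + p)) second ⟨
    u (i + j + p)                ∎
    where open ≡-Reasoning

FourMinusAt-φω⁺ : ∀ w m q → FourMinusAt w m q → ∃ λ r → FourMinusAt (φω w) (pos w m) r
FourMinusAt-φω⁺ w m q per with m≤n⇒∃[o]m+o≡n (pos-mono-< w (m<m+n m {suc q} z<s))
... | r , eq = r , Substitution.periodic w m q r per (trans (sym eq) (sym (+-suc (pos w m) r)))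

-- The window of φω w may end inside a block, so blocks m + s and m + Q + s are only known to stay
-- p letters apart while the second letter of block m + s lies in the window (InWindow s).  This is
-- checked for the first 3Q - 1 blocks one period at a time; the last period needs p ≥ 2 and that
-- two consecutive blocks of a word without 11 span at least 3 letters.
module Desubstitution (w : ωWord) (noEleven : NoEleven w) (m q r : ℕ)
                      (per : FourMinusAt (φω w) (pos w m) (suc r))
                      (aligned : pos w (m + suc q) ≡ pos w m + suc (suc r)) where
  Q = suc q
  p = suc (suc r)
  nᵤ = p + (p + suc r)
  u = φω w
  i = pos w m

  InWindow : ℕ → Set
  InWindow s = suc (pos w (m + s)) < i + nᵤ

  letters-agree : ∀ s → InWindow s → pos w (m + Q + s) ≡ pos w (m + s) + p → w (m + Q + s) ≡ w (m + s)
  letters-agree s in-window aligned-s = complement-injective (begin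
    complement (w (m + Q + s))    ≡⟨ φω-suc-pos w (m + Q + s) ⟨
    u (suc (pos w (m + Q + s)))   ≡⟨ cong (u ∘ suc) aligned-s ⟩
    u (suc (pos w (m + s)) + p)   ≡⟨ periodic-at u p i nᵤ per i≤ in-window ⟨
    u (suc (pos w (m + s)))       ≡⟨ φω-suc-pos w (m + s) ⟩
    complement (w (m + s))        ∎)
    where
    open ≡-Reasoning
    i≤ : i ≤ suc (pos w (m + s))
    i≤ = ≤-trans (pos-mono-≤ w (m≤m+n m s)) (n≤1+n _)

  aligned-at : ∀ t → (∀ s → s < t → InWindow s) → pos w (m + Q + t) ≡ pos w (m + t) + p
  aligned-at t in-window = pos-lockstep w {m} {m + Q} aligned t (λ s s<t → letters-agree s (in-window s s<t))

  inWindow-first : ∀ s → s < Q → InWindow s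
  inWindow-first s s<Q = begin-strict
    suc (pos w (m + s))  ≤⟨ pos-mono-< w (+-monoʳ-< m s<Q) ⟩
    pos w (m + Q)        ≡⟨ aligned ⟩
    i + p                <⟨ +-monoʳ-< i (m<m+n p z<s) ⟩
    i + nᵤ               ∎
    where open ≤-Reasoning

  aligned-first : ∀ s → s < Q → pos w (m + Q + s) ≡ pos w (m + s) + p
  aligned-first s s<Q = aligned-at s (λ s′ s′<s → inWindow-first s′ (<-trans s′<s s<Q))

  inWindow-second : ∀ s → s < Q → InWindow (Q + s)
  inWindow-second s s<Q = begin-strict
    suc (pos w (m + (Q + s)))  ≡⟨ cong (suc ∘ pos w) (+-assoc m Q s) ⟨
    suc (pos w (m + Q + s))    ≡⟨ cong suc (aligned-first s s<Q) ⟩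
    suc (pos w (m + s) + p)    ≤⟨ +-monoˡ-< p (pos-mono-< w (+-monoʳ-< m s<Q)) ⟩
    pos w (m + Q) + p          ≡⟨ cong (_+ p) aligned ⟩
    i + p + p                  ≡⟨ +-assoc i p p ⟩
    i + (p + p)                <⟨ +-monoʳ-< i (+-monoʳ-< p (m<m+n p z<s)) ⟩
    i + nᵤ                     ∎
    where open ≤-Reasoning

  inWindow-below-2Q : ∀ s → s < Q + Q → InWindow s
  inWindow-below-2Q s s<2Q with s <? Q
  ... | yes s<Q = inWindow-first s s<Q
  ... | no s≮Q with m≤n⇒∃[o]m+o≡n (≮⇒≥ s≮Q)
  ...   | s′ , refl = inWindow-second s′ (+-cancelˡ-< Q _ _ s<2Q)

  inWindow-third : ∀ s → suc s < Q → InWindow (Q + Q + s)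
  inWindow-third s s+1<Q = begin-strict
    suc (pos w (m + (Q + Q + s)))  ≡⟨ cong (suc ∘ pos w) (regroup-index m Q s) ⟩
    suc (pos w (m + Q + (Q + s)))  ≡⟨ cong suc aligned-second ⟩
    suc (pos w (m + (Q + s)) + p)  ≡⟨ cong (λ x → suc (pos w x + p)) (+-assoc m Q s) ⟨
    suc (pos w (m + Q + s) + p)    ≡⟨ cong (λ x → suc (x + p)) (aligned-first s s<Q) ⟩
    suc (pos w (m + s) + p + p)    <⟨ +-monoˡ-≤ p (+-monoˡ-≤ p two-before) ⟩
    i + suc r + p + p              ≡⟨ regroup i r ⟩
    i + nᵤ                         ∎
    where
    open ≤-Reasoning
    s<Q : s < Q
    s<Q = <-trans (n<1+n s) s+1<Q
    regroup : ∀ i r → i + suc r + suc (suc r) + suc (suc r) ≡ i + (suc (suc r) + (suc (suc r) + suc r))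
    regroup = solve-∀
    regroup-index : ∀ m Q s → m + (Q + Q + s) ≡ m + Q + (Q + s)
    regroup-index = solve-∀
    aligned-second : pos w (m + Q + (Q + s)) ≡ pos w (m + (Q + s)) + p
    aligned-second = aligned-at (Q + s) λ s′ s′<Q+s →
      inWindow-below-2Q s′ (<-trans s′<Q+s (+-monoʳ-< Q s<Q))
    two-before : 2 + pos w (m + s) ≤ i + suc r
    two-before = s≤s⁻¹ (begin
      3 + pos w (m + s)          ≤⟨ pos-suc-suc w noEleven (m + s) ⟩
      pos w (suc (suc (m + s)))  ≡⟨ cong (pos w) (trans (+-suc m (suc s)) (cong suc (+-suc m s))) ⟨
      pos w (m + suc (suc s))    ≤⟨ pos-mono-≤ w (+-monoʳ-≤ m s+1<Q) ⟩
      pos w (m + Q)              ≡⟨ aligned ⟩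
      i + p                      ≡⟨ +-suc i (suc r) ⟩
      suc (i + suc r)            ∎)

  inWindow : ∀ t → t < Q + (Q + q) → InWindow t
  inWindow t t<n with t <? Q + Q
  ... | yes t<2Q = inWindow-below-2Q t t<2Q
  ... | no t≮2Q with m≤n⇒∃[o]m+o≡n (≮⇒≥ t≮2Q)
  ...   | s , refl =
    inWindow-third s (s<s (+-cancelˡ-< (Q + Q) _ _ (subst (Q + Q + s <_) (sym (+-assoc Q Q q)) t<n)))

  desubstituted : FourMinusAt w m q
  desubstituted t t<n = sym (trans (cong w (xy∙z≈xz∙y m t Q))
    (letters-agree t (inWindow t t<n) (aligned-at t (λ s s<t → inWindow s (<-trans s<t t<n)))))

FourMinusAt-φω-block⁻ : ∀ w → NoEleven w → ∀ m r → FourMinusAt (φω w) (pos w m) (suc r) →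
  ∃ λ q → FourMinusAt w m q
FourMinusAt-φω-block⁻ w noEleven m r per =
  let (m′ , next)       = φω-zero⇒pos w (pos w m + p) period-zero
      (q , suc-m+q≡m′) = m≤n⇒∃[o]m+o≡n (pos-cancel-< w {m} {m′} (subst (pos w m <_) next (m<m+n _ z<s)))
  in q , Desubstitution.desubstituted w noEleven m q r per
           (trans (cong (pos w) (trans (+-suc m q) suc-m+q≡m′)) (sym next))
  where
  p = suc (suc r)
  period-zero : φω w (pos w m + p) ≡ b0
  period-zero = trans (sym (FourMinusAt-start (φω w) (pos w m) (suc r) per)) (φω-pos w m)

FourMinusAt-φω⁻ : ∀ w → NoEleven w → ∀ i r → FourMinusAt (φω w) i r →
  ∃₂ λ m q → FourMinusAt w m q
FourMinusAt-φω⁻ w noEleven i r per with FourMinusAt-at-zero (φω w) (φω-noEleven w) (φω-head w) i r per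
FourMinusAt-φω⁻ w noEleven i zero per | i′ , ui′≡0 , per′ with FourMinusAt⇒cube (φω w) i′ per′
... | e₀ , e₁ = ⊥-elim (φω-no000 w noEleven i′ ui′≡0 ui′+1≡0 (trans (sym e₁) ui′+1≡0))
  where
  ui′+1≡0 : φω w (suc i′) ≡ b0
  ui′+1≡0 = trans (sym e₀) ui′≡0
FourMinusAt-φω⁻ w noEleven i (suc r) per | i′ , ui′≡0 , per′ with φω-zero⇒pos w i′ ui′≡0
... | m , refl = m , FourMinusAt-φω-block⁻ w noEleven m r per′

eleven⇒FourMinusAt-φω : ∀ w k → w k ≡ b1 → w (suc k) ≡ b1 → FourMinusAt (φω w) (pos w k) 0
eleven⇒FourMinusAt-φω w k wk≡1 wk+1≡1 =
  cube⇒FourMinusAt (φω w) (pos w k) (trans zero₀ (sym zero₁)) (trans zero₁ (sym zero₂))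
  where
  zero₀ : φω w (pos w k) ≡ b0
  zero₀ = φω-pos w k
  zero₁ : φω w (suc (pos w k)) ≡ b0
  zero₁ = trans (φω-suc-pos w k) (cong complement wk≡1)
  zero₂ : φω w (suc (suc (pos w k))) ≡ b0
  zero₂ = trans (cong (φω w ∘ suc) (sym (pos-suc-of w wk≡1)))
                (trans (φω-suc-pos w (suc k)) (cong complement wk+1≡1))

NoFourMinus-φω⁻ : ∀ w → NoFourMinus (φω w) → NoEleven w × NoFourMinus w
NoFourMinus-φω⁻ w no4⁻ =
  (λ k wk≡1 wk+1≡1 → no4⁻ (pos w k) 0 (eleven⇒FourMinusAt-φω w k wk≡1 wk+1≡1)) ,
  (λ m q per → let (r , per′) = FourMinusAt-φω⁺ w m q per in no4⁻ (pos w m) r per′)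

NoFourMinus-φω⁺ : ∀ w → NoEleven w → NoFourMinus w → NoFourMinus (φω w)
NoFourMinus-φω⁺ w noEleven no4⁻ i r per =
  let (m , q , per′) = FourMinusAt-φω⁻ w noEleven i r per in no4⁻ m q per′

theorem6 : (w : ωWord) → FauxBonacci (φω w) ⇔ FauxBonacci w
theorem6 w = mk⇔
  (λ fb → from (FauxBonacci⇔ w) (NoFourMinus-φω⁻ w (proj₂ (to (FauxBonacci⇔ (φω w)) fb))))
  (λ fb → let (noEleven , no4⁻) = to (FauxBonacci⇔ w) fb in
          from (FauxBonacci⇔ (φω w)) (φω-noEleven w , NoFourMinus-φω⁺ w noEleven no4⁻))
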